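{- For any integer $m\geq 1$, the number of graphs on the vertex set $\{1,\dots,n\}$ that are intersection graphs of $n$ numbered axis-parallel boxes in $\mathbb{R}^m$ equals $n^{(2m+o(1))n}$, where $o(1)\to 0$ as $n\to\infty$.
   Context: Given $n$ objects numbered $1,\dots,n$, their intersection graph is the graph on $\{1,\dots,n\}$ in which $i$ and $j$ are adjacent if and only if the objects numbered $i$ and $j$ intersect.
   Formalization: The boxes have rational endpoints, lying in ℚ^m instead of $\mathbb{R}^m$. -}

module Defs where

open import Data.Nat using (ℕ)
open import Data.Bool using (Bool; true; false)
open import Data.Fin using (Fin)
open import Data.Vec using (Vec; lookup)
open import Data.List using (List; length)
open import Data.List.Relation.Unary.Unique.Propositional using (Unique)
open import Data.List.Membership.Propositional using (_∈_)
open import Data.Product using (Σ; _×_; ∃)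
open import Data.Rational using (ℚ; _≤_)
open import Relation.Binary.PropositionalEquality using (_≡_)
open import Function.Bundles using (_⇔_)

record Graph (n : ℕ) : Set where
  constructor mkGraph
  field
    adj   : Vec (Vec Bool n) n
    irrefl : ∀ i → lookup (lookup adj i) i ≡ false
    sym    : ∀ i j → lookup (lookup adj i) j ≡ lookup (lookup adj j) i

Adj : ∀ {n} → Graph n → Fin n → Fin n → Set
Adj G i j = lookup (lookup (Graph.adj G) i) j ≡ true

record Box (m : ℕ) : Set where
  constructor mkBox
  field
    lo hi : Fin m → ℚ
    lo≤hi : ∀ d → lo d ≤ hi d

Intersect : ∀ {m} → Box m → Box m → Set
Intersect {m} A B = ∀ (d : Fin m) → (Box.lo A d ≤ Box.hi B d) × (Box.lo B d ≤ Box.hi A d)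

IsIntersectionGraphOf : ∀ {m n} → Graph n → (Fin n → Box m) → Set
IsIntersectionGraphOf {m} {n} G b =
  ∀ (i j : Fin n) → ¬≡ i j → (Adj G i j ⇔ Intersect (b i) (b j))
  where
  open import Relation.Nullary using (¬_)
  ¬≡ : Fin n → Fin n → Set
  ¬≡ i j = ¬ (i ≡ j)

IsBoxGraph : (m : ℕ) → ∀ {n} → Graph n → Set
IsBoxGraph m {n} G = Σ (Fin n → Box m) λ b → IsIntersectionGraphOf G b

BoxGraphCount : (m n c : ℕ) → Set
BoxGraphCount m n c =
  Σ (List (Graph n)) λ l →
    Unique (Data.List.map Graph.adj l) ×
    (∀ (G : Graph n) → (Graph.adj G ∈ Data.List.map Graph.adj l ⇔ IsBoxGraph m G)) ×
    length l ≡ c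
  where import Data.List

-- Upper bound: replacing every endpoint by its rank among the 2n endpoints on the same axis
-- keeps every comparison between a lower and an upper endpoint, hence the intersection graph.
-- So each box graph is realised by boxes with integer endpoints in [0, 2n], of which there are
-- (2n + 1)^(2mn).
--
-- Lower bound: write n = f + 2hm.  Give f "free" boxes on every axis an interval [x, h + y]
-- with x, y < h, and add, for every axis d and every p < 2h, a "probe" box that is the point p
-- on axis d and [0, 2h] on all other axes.  A free box meets the probe (d, p) iff x ≤ p ≤ h + y
-- on axis d, so the graph determines every pair (x, y): there are at least h^(2fm) box graphs.
-- Taking h = n / (8m²k), so that f ≥ n - n/(4mk), the two counts give
-- n^((2m - 1/k) n) ≤ c ≤ n^((2m + 1/k) n) once n is large.

module Submission where

open import Defs
open import Data.Nat using (ℕ; _*_; _^_; _∸_; _+_; _≤_)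
open import Data.Product using (Σ; _×_)

open import Data.Bool using (Bool; true)
import Data.Bool.Properties as Bool
open import Data.Empty using (⊥-elim)
open import Data.Fin as Fin
  using (Fin; zero; suc; toℕ; fromℕ<; _↑ˡ_; _↑ʳ_; splitAt; combine; remQuot; finToFun; funToFin)
import Data.Fin.Properties as Fin
open import Data.Integer using (+_; +≤+) renaming (_≤_ to _≤ℤ_)
import Data.Integer.Properties as ℤ
open import Data.List using (List; []; _∷_; map; _++_; length; allFin; lookup; deduplicate; tabulate)
import Data.List.Properties as List
open import Data.List.Membership.Propositional using (_∈_)
import Data.List.Membership.Propositional.Properties as ∈
open import Data.List.Membership.Setoid.Properties using (index-injective)
import Data.List.Relation.Unary.All as All
open import Data.List.Relation.Unary.AllPairs using (_∷_)
import Data.List.Relation.Unary.AllPairs.Properties as AllPairs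
open import Data.List.Relation.Unary.Any using (here; there)
import Data.List.Relation.Unary.Any.Properties as Any
open import Data.List.Relation.Unary.Unique.Propositional using (Unique)
import Data.List.Relation.Unary.Unique.DecSetoid.Properties as Unique
open import Data.Nat as ℕ using (zero; suc; _<_; z≤n; s≤s; _⊔_; _/_; _%_; NonZero)
import Data.Nat.DivMod as DivMod
import Data.Nat.Properties as ℕ
open import Data.Nat.Coprimality using (1-coprimeTo) renaming (sym to coprime-sym)
open import Data.Nat.Tactic.RingSolver using (solve-∀)
open import Data.Product as Product using (_,_; proj₁; proj₂; uncurry; swap)
open import Data.Product.Properties using (×-≡,≡→≡)
open import Data.Rational as ℚ using (ℚ; mkℚ; *≤*)
import Data.Rational.Properties as ℚ
open import Data.Sum using ([_,_]′)
open import Data.Vec as Vec using (Vec)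
import Data.Vec.Properties as Vec
open import Function using (_∘_; id)
open import Function.Bundles using (_⇔_; mk⇔; Equivalence)
open import Function.Definitions using (Injective)
open import Level using (0ℓ)
import Function.Properties.Equivalence as ⇔
open import Relation.Binary using (Rel; Symmetric; Decidable; DecTotalOrder; DecSetoid)
import Relation.Binary.Construct.On as On
open import Relation.Binary.PropositionalEquality
open import Relation.Nullary using (Dec; yes; no; does; _×-dec_; ¬?)
open import Relation.Nullary.Decidable using (dec-true; dec-false; does-⇔)

fromℕ : ℕ → ℚ
fromℕ a = mkℚ (+ a) 0 (coprime-sym (1-coprimeTo a))

fromℕ-≤⇔ : ∀ {a b} → fromℕ a ℚ.≤ fromℕ b ⇔ a ≤ b
fromℕ-≤⇔ {a} {b} = mk⇔
  (λ { (*≤* p) → ℤ.drop‿+≤+ (subst₂ _≤ℤ_ (ℤ.*-identityʳ (+ a)) (ℤ.*-identityʳ (+ b)) p) })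
  (λ a≤b → *≤* (subst₂ _≤ℤ_ (sym (ℤ.*-identityʳ (+ a))) (sym (ℤ.*-identityʳ (+ b))) (+≤+ a≤b)))

module Rank {a ℓ₁ ℓ₂} (O : DecTotalOrder a ℓ₁ ℓ₂) where
  open DecTotalOrder O using (module Eq)
    renaming (Carrier to A; _≤_ to _⊑_; _≤?_ to _⊑?_; trans to ⊑-trans)
  open import Relation.Binary.Properties.DecTotalOrder O
    renaming (_<_ to _⊏_)
    using (<-irrefl; <-trans; <⇒≱; ≰⇒>; ≮⇒≥; <-strictTotalOrder)
  open import Relation.Binary.Bundles using (StrictTotalOrder)
  open StrictTotalOrder <-strictTotalOrder using () renaming (_<?_ to _⊏?_)

  rank : List A → A → ℕ
  rank []      x = 0
  rank (e ∷ E) x with e ⊏? x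
  ... | yes _ = suc (rank E x)
  ... | no  _ = rank E x

  rank≤length : ∀ E x → rank E x ℕ.≤ length E
  rank≤length []      x = z≤n
  rank≤length (e ∷ E) x with e ⊏? x
  ... | yes _ = s≤s (rank≤length E x)
  ... | no  _ = ℕ.m≤n⇒m≤1+n (rank≤length E x)

  rank-mono-≤ : ∀ E {x y} → x ⊑ y → rank E x ℕ.≤ rank E y
  rank-mono-≤ []      x⊑y = z≤n
  rank-mono-≤ (e ∷ E) {x} {y} x⊑y with e ⊏? x | e ⊏? y
  ... | yes _   | yes _   = s≤s (rank-mono-≤ E x⊑y)
  ... | yes e⊏x | no  ¬e⊏y = ⊥-elim (<⇒≱ e⊏x (⊑-trans x⊑y (≮⇒≥ ¬e⊏y)))
  ... | no  _   | yes _   = ℕ.m≤n⇒m≤1+n (rank-mono-≤ E x⊑y)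
  ... | no  _   | no  _   = rank-mono-≤ E x⊑y

  rank-mono-< : ∀ E {x y} → y ∈ E → y ⊏ x → rank E y ℕ.< rank E x
  rank-mono-< (e ∷ E) {x} {y} _ _ with e ⊏? y | e ⊏? x
  rank-mono-< (e ∷ E) (here refl)  y⊏x | yes e⊏e | _       = ⊥-elim (<-irrefl Eq.refl e⊏e)
  rank-mono-< (e ∷ E) (here refl)  y⊏x | no  _   | yes _   = s≤s (rank-mono-≤ E (proj₁ y⊏x))
  rank-mono-< (e ∷ E) (here refl)  y⊏x | no  _   | no  ¬e⊏x = ⊥-elim (¬e⊏x y⊏x)
  rank-mono-< (e ∷ E) (there y∈E) y⊏x | yes _   | yes _   = s≤s (rank-mono-< E y∈E y⊏x)
  rank-mono-< (e ∷ E) (there y∈E) y⊏x | yes e⊏y | no  ¬e⊏x = ⊥-elim (¬e⊏x (<-trans e⊏y y⊏x))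
  rank-mono-< (e ∷ E) (there y∈E) y⊏x | no  _   | yes _   = ℕ.m≤n⇒m≤1+n (rank-mono-< E y∈E y⊏x)
  rank-mono-< (e ∷ E) (there y∈E) y⊏x | no  _   | no  _   = rank-mono-< E y∈E y⊏x

  rank-≤⇔ : ∀ E {x y} → y ∈ E → rank E x ℕ.≤ rank E y ⇔ x ⊑ y
  rank-≤⇔ E {x} {y} y∈E = mk⇔ from (rank-mono-≤ E)
    where
    from : rank E x ℕ.≤ rank E y → x ⊑ y
    from rx≤ry with x ⊑? y
    ... | yes x⊑y = x⊑y
    ... | no  x⋢y = ⊥-elim (ℕ.<⇒≱ (rank-mono-< E y∈E (≰⇒> x⋢y)) rx≤ry)

funToFin-cong : ∀ {a q} {φ ψ : Fin a → Fin q} → (∀ t → φ t ≡ ψ t) → funToFin φ ≡ funToFin ψ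
funToFin-cong {zero}  φ≗ψ = refl
funToFin-cong {suc a} φ≗ψ = cong₂ combine (φ≗ψ zero) (funToFin-cong (φ≗ψ ∘ suc))

Table : ℕ → ℕ → ℕ → Set
Table a b q = Fin a → Fin b → Fin q × Fin q

table : ∀ {a b q} → Fin ((q * q) ^ (a * b)) → Table a b q
table {q = q} k i j = remQuot q (finToFun k (combine i j))

tableIndex : ∀ {a b q} → Table a b q → Fin ((q * q) ^ (a * b))
tableIndex {b = b} φ = funToFin (λ t → uncurry combine (uncurry φ (remQuot b t)))

table-tableIndex : ∀ {a b q} (φ : Table a b q) i j → table {a} {b} {q} (tableIndex φ) i j ≡ φ i j
table-tableIndex {b = b} {q} φ i j = begin
  remQuot q (finToFun (tableIndex φ) (combine i j))
    ≡⟨ cong (remQuot q) (Fin.finToFun-funToFin _ (combine i j)) ⟩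
  remQuot q (uncurry combine (uncurry φ (remQuot b (combine i j))))
    ≡⟨ cong (remQuot q ∘ uncurry combine ∘ uncurry φ) (Fin.remQuot-combine i j) ⟩
  remQuot q (uncurry combine (φ i j))
    ≡⟨ Fin.remQuot-combine (proj₁ (φ i j)) (proj₂ (φ i j)) ⟩
  φ i j
    ∎
  where open ≡-Reasoning

tableIndex-table : ∀ {a b q} (k : Fin ((q * q) ^ (a * b))) → tableIndex (table {a} {b} {q} k) ≡ k
tableIndex-table {a} {b} {q} k = trans (funToFin-cong entry) (Fin.funToFin-finToFin {a * b} {q * q} k)
  where
  entry : ∀ t → uncurry combine (uncurry (table {a} {b} {q} k) (remQuot b t)) ≡ finToFun k t
  entry t = trans (Fin.combine-remQuot {q} q _) (cong (finToFun k) (Fin.combine-remQuot {a} b t))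

tableIndex-cong : ∀ {a b q} {φ ψ : Table a b q} → (∀ i j → φ i j ≡ ψ i j) →
                  tableIndex φ ≡ tableIndex ψ
tableIndex-cong {b = b} φ≗ψ = funToFin-cong (λ t → cong (uncurry combine) (uncurry φ≗ψ (remQuot b t)))

table-injective : ∀ {a b q} {k k' : Fin ((q * q) ^ (a * b))} →
                  (∀ i j → table {a} {b} {q} k i j ≡ table k' i j) → k ≡ k'
table-injective {a} {b} {q} {k} {k'} k≗k' = begin
  k                                  ≡⟨ tableIndex-table {a} {b} {q} k ⟨
  tableIndex (table {a} {b} {q} k)   ≡⟨ tableIndex-cong k≗k' ⟩
  tableIndex (table {a} {b} {q} k')  ≡⟨ tableIndex-table {a} {b} {q} k' ⟩
  k'                                 ∎
  where open ≡-Reasoning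

injective⇒≤length : ∀ {B : Set} {s} {ys : List B} (g : Fin s → B) → Injective _≡_ _≡_ g →
                    (∀ t → g t ∈ ys) → s ≤ length ys
injective⇒≤length g g-injective g∈ys =
  Fin.injective⇒≤ (λ {t} {u} eq → g-injective (index-injective (setoid _) (g∈ys t) (g∈ys u) eq))

lookup-injective : ∀ {A : Set} {xs : List A} → Unique xs → Injective _≡_ _≡_ (lookup xs)
lookup-injective (_    ∷ _) {zero}  {zero}  _  = refl
lookup-injective (x∉xs ∷ _) {zero}  {suc t} eq = ⊥-elim (All.lookup x∉xs (∈.∈-lookup t) eq)
lookup-injective (x∉xs ∷ _) {suc s} {zero}  eq = ⊥-elim (All.lookup x∉xs (∈.∈-lookup s) (sym eq))
lookup-injective (_    ∷ u) {suc s} {suc t} eq = cong suc (lookup-injective u eq)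

lookup-ext : ∀ {A : Set} {n} (xs ys : Vec A n) → (∀ i → Vec.lookup xs i ≡ Vec.lookup ys i) → xs ≡ ys
lookup-ext Vec.[]       Vec.[]       _   = refl
lookup-ext (x Vec.∷ xs) (y Vec.∷ ys) x≗y = cong₂ Vec._∷_ (x≗y zero) (lookup-ext xs ys (x≗y ∘ suc))

adj-ext : ∀ {n} (G H : Graph n) → (∀ i j → i ≢ j → Adj G i j ⇔ Adj H i j) →
          Graph.adj G ≡ Graph.adj H
adj-ext G H G⇔H = lookup-ext _ _ λ i → lookup-ext _ _ λ j → entry i j
  where
  entry : ∀ i j → Vec.lookup (Vec.lookup (Graph.adj G) i) j ≡ Vec.lookup (Vec.lookup (Graph.adj H) i) j
  entry i j with i Fin.≟ j
  ... | yes refl = trans (Graph.irrefl G i) (sym (Graph.irrefl H i))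
  ... | no  i≢j  = Bool.⇔→≡ (G⇔H i j i≢j)

Adj-resp : ∀ {n} (G H : Graph n) → Graph.adj G ≡ Graph.adj H → ∀ i j → Adj G i j ⇔ Adj H i j
Adj-resp G H G≡H i j = mk⇔ (subst (λ M → Vec.lookup (Vec.lookup M i) j ≡ true) G≡H)
                           (subst (λ M → Vec.lookup (Vec.lookup M i) j ≡ true) (sym G≡H))

does-true⇒ : ∀ {p} {P : Set p} (P? : Dec P) → does P? ≡ true → P
does-true⇒ (yes p) _ = p

module _ {n ℓ} {R : Rel (Fin n) ℓ} (R-sym : Symmetric R) (R? : Decidable R) where

  private
    Edge : Fin n → Fin n → Set ℓ
    Edge i j = i ≢ j × R i j

    edge? : ∀ i j → Dec (Edge i j)
    edge? i j = ¬? (i Fin.≟ j) ×-dec R? i j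

    edge-sym : ∀ {i j} → Edge i j → Edge j i
    edge-sym (i≢j , Rij) = i≢j ∘ sym , R-sym Rij

    adjacency : Vec (Vec Bool n) n
    adjacency = Vec.tabulate λ i → Vec.tabulate λ j → does (edge? i j)

    lookup-adjacency : ∀ i j → Vec.lookup (Vec.lookup adjacency i) j ≡ does (edge? i j)
    lookup-adjacency i j =
      trans (cong (λ row → Vec.lookup row j) (Vec.lookup∘tabulate _ i)) (Vec.lookup∘tabulate _ j)

  relationGraph : Graph n
  relationGraph = mkGraph adjacency
    (λ i → trans (lookup-adjacency i i) (dec-false (edge? i i) (λ (i≢i , _) → i≢i refl)))
    (λ i j → trans (lookup-adjacency i j)
               (trans (does-⇔ (mk⇔ edge-sym edge-sym) (edge? i j) (edge? j i)) (sym (lookup-adjacency j i))))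

  Adj-relationGraph : ∀ i j → Adj relationGraph i j ⇔ Edge i j
  Adj-relationGraph i j = mk⇔
    (λ adj → does-true⇒ (edge? i j) (trans (sym (lookup-adjacency i j)) adj))
    (λ e → trans (lookup-adjacency i j) (dec-true (edge? i j) e))

intersect? : ∀ {m} → Decidable (Intersect {m})
intersect? A B = Fin.all? λ d → (Box.lo A d ℚ.≤? Box.hi B d) ×-dec (Box.lo B d ℚ.≤? Box.hi A d)

intersect-sym : ∀ {m} (A B : Box m) → Intersect A B → Intersect B A
intersect-sym A B A∩B d = swap (A∩B d)

module _ {m n} (b : Fin n → Box m) where

  private
    Meet : Rel (Fin n) _
    Meet i j = Intersect (b i) (b j)

    meet-sym : Symmetric Meet
    meet-sym {i} {j} = intersect-sym (b i) (b j)

    meet? : Decidable Meet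
    meet? i j = intersect? (b i) (b j)

  intersectionGraph : Graph n
  intersectionGraph = relationGraph meet-sym meet?

  Adj-intersectionGraph : ∀ {i j} → i ≢ j → Adj intersectionGraph i j ⇔ Intersect (b i) (b j)
  Adj-intersectionGraph {i} {j} i≢j = ⇔.trans (Adj-relationGraph meet-sym meet? i j) (mk⇔ proj₂ (i≢j ,_))

isIntersectionGraphOf⇔adj≡ : ∀ {m n} (G : Graph n) (b : Fin n → Box m) →
                             IsIntersectionGraphOf G b ⇔ Graph.adj G ≡ Graph.adj (intersectionGraph b)
isIntersectionGraphOf⇔adj≡ G b = mk⇔
  (λ G∼b → adj-ext G (intersectionGraph b) λ i j i≢j →
     ⇔.trans (G∼b i j i≢j) (⇔.sym (Adj-intersectionGraph b i≢j)))
  (λ G≡ i j i≢j → ⇔.trans (Adj-resp G (intersectionGraph b) G≡ i j) (Adj-intersectionGraph b i≢j))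

intersectionGraph-isBoxGraph : ∀ {m n} (b : Fin n → Box m) → IsBoxGraph m (intersectionGraph b)
intersectionGraph-isBoxGraph b = b , Equivalence.from (isIntersectionGraphOf⇔adj≡ (intersectionGraph b) b) refl

SameEndpointOrder : ∀ {m n} → (Fin n → Box m) → (Fin n → Box m) → Set
SameEndpointOrder b b' =
  ∀ i j d → Box.lo (b i) d ℚ.≤ Box.hi (b j) d ⇔ Box.lo (b' i) d ℚ.≤ Box.hi (b' j) d

isIntersectionGraphOf-resp : ∀ {m n} {G : Graph n} (b b' : Fin n → Box m) →
                             SameEndpointOrder b b' → IsIntersectionGraphOf G b → IsIntersectionGraphOf G b'
isIntersectionGraphOf-resp b b' b∼b' G∼b i j i≢j = ⇔.trans (G∼b i j i≢j) (mk⇔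
  (λ bi∩bj d → Product.map (Equivalence.to (b∼b' i j d)) (Equivalence.to (b∼b' j i d)) (bi∩bj d))
  (λ bi∩bj d → Product.map (Equivalence.from (b∼b' i j d)) (Equivalence.from (b∼b' j i d)) (bi∩bj d)))

ℕBox : ∀ {m} (lo hi : Fin m → ℕ) → (∀ d → lo d ≤ hi d) → Box m
ℕBox lo hi lo≤hi = mkBox (fromℕ ∘ lo) (fromℕ ∘ hi) (λ d → Equivalence.from fromℕ-≤⇔ (lo≤hi d))

ℕBox-intersect⇔ : ∀ {m} {lo hi lo' hi' : Fin m → ℕ}
                  (lo≤hi : ∀ d → lo d ≤ hi d) (lo≤hi' : ∀ d → lo' d ≤ hi' d) →
                  Intersect (ℕBox lo hi lo≤hi) (ℕBox lo' hi' lo≤hi') ⇔ (∀ d → lo d ≤ hi' d × lo' d ≤ hi d)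
ℕBox-intersect⇔ _ _ = mk⇔
  (λ A∩B d → Product.map (Equivalence.to fromℕ-≤⇔) (Equivalence.to fromℕ-≤⇔) (A∩B d))
  (λ A∩B d → Product.map (Equivalence.from fromℕ-≤⇔) (Equivalence.from fromℕ-≤⇔) (A∩B d))

boxGraphCount≤length : ∀ {m n c} → BoxGraphCount m n c → (L : List (Graph n)) →
                       (∀ G → IsBoxGraph m G → Graph.adj G ∈ map Graph.adj L) → c ≤ length L
boxGraphCount≤length (l , unique , l⇔ , refl) L covers =
  subst₂ _≤_ (List.length-map Graph.adj l) (List.length-map Graph.adj L)
    (injective⇒≤length (lookup (map Graph.adj l)) (lookup-injective unique) lookup∈L)
  where
  lookup∈L : ∀ t → lookup (map Graph.adj l) t ∈ map Graph.adj L
  lookup∈L t =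
    let G , G∈l , eq = ∈.∈-map⁻ Graph.adj (∈.∈-lookup {xs = map Graph.adj l} t)
    in  subst (_∈ map Graph.adj L) (sym eq) (covers G (Equivalence.to (l⇔ G) (∈.∈-map⁺ Graph.adj G∈l)))

injective≤boxGraphCount : ∀ {m n c s} → BoxGraphCount m n c → (G : Fin s → Graph n) →
                          (∀ t → IsBoxGraph m (G t)) → Injective _≡_ _≡_ (Graph.adj ∘ G) → s ≤ c
injective≤boxGraphCount (l , _ , l⇔ , refl) G boxG G-injective =
  subst (_ ≤_) (List.length-map Graph.adj l)
    (injective⇒≤length (Graph.adj ∘ G) G-injective (λ t → Equivalence.from (l⇔ (G t)) (boxG t)))

boxGraphCount-deduplicate : ∀ {m n} (L : List (Graph n)) →
                            (∀ G → Graph.adj G ∈ map Graph.adj L ⇔ IsBoxGraph m G) →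
                            Σ ℕ (BoxGraphCount m n)
boxGraphCount-deduplicate {m} {n} L L⇔ =
  length l , l , unique , (λ G → ⇔.trans (∈l⇔∈L G) (L⇔ G)) , refl
  where
  SameAdjacency : DecSetoid _ _
  SameAdjacency = On.decSetoid (decSetoid (Vec.≡-dec (Vec.≡-dec Bool._≟_))) (Graph.adj {n})

  open DecSetoid SameAdjacency using (_≟_)

  l : List (Graph n)
  l = deduplicate _≟_ L

  unique : Unique (map Graph.adj l)
  unique = AllPairs.map⁺ (Unique.deduplicate-! SameAdjacency L)

  ∈l⇔∈L : ∀ G → Graph.adj G ∈ map Graph.adj l ⇔ Graph.adj G ∈ map Graph.adj L
  ∈l⇔∈L G = mk⇔
    (Any.map⁺ ∘ Any.deduplicate⁻ _≟_ ∘ Any.map⁻)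
    (Any.map⁺ ∘ Any.deduplicate⁺ _≟_ (λ H≡H' G≡H → trans G≡H (sym H≡H')) ∘ Any.map⁻)

-- The ⊔ makes every table a family of boxes, not only those whose entries satisfy x ≤ y.
tableBoxes : ∀ {n m q} → Table n m q → Fin n → Box m
tableBoxes φ i = ℕBox (λ d → toℕ (proj₁ (φ i d)))
                      (λ d → toℕ (proj₁ (φ i d)) ⊔ toℕ (proj₂ (φ i d)))
                      (λ d → ℕ.m≤m⊔n _ _)

module Normalisation {n m} (b : Fin n → Box m) where
  open Rank ℚ.≤-decTotalOrder

  endpoints : Fin m → List ℚ
  endpoints d = tabulate (λ i → Box.lo (b i) d) ++ tabulate (λ i → Box.hi (b i) d)

  rank< : ∀ d x → rank (endpoints d) x < suc (n + n)
  rank< d x = s≤s (subst (rank (endpoints d) x ≤_) length-endpoints (rank≤length (endpoints d) x))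
    where
    length-endpoints : length (endpoints d) ≡ n + n
    length-endpoints = trans (List.length-++ (tabulate (λ i → Box.lo (b i) d)))
      (cong₂ _+_ (List.length-tabulate (λ i → Box.lo (b i) d))
                 (List.length-tabulate (λ i → Box.hi (b i) d)))

  normalTable : Table n m (suc (n + n))
  normalTable i d = fromℕ< (rank< d (Box.lo (b i) d)) , fromℕ< (rank< d (Box.hi (b i) d))

  normalBoxes : Fin n → Box m
  normalBoxes = tableBoxes (table {n} {m} {suc (n + n)} (tableIndex normalTable))

  lo-normalBoxes : ∀ i d → Box.lo (normalBoxes i) d ≡ fromℕ (rank (endpoints d) (Box.lo (b i) d))
  lo-normalBoxes i d = cong fromℕ (trans (cong (toℕ ∘ proj₁) (table-tableIndex normalTable i d))
                                         (Fin.toℕ-fromℕ< (rank< d (Box.lo (b i) d))))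

  hi-normalBoxes : ∀ i d → Box.hi (normalBoxes i) d ≡ fromℕ (rank (endpoints d) (Box.hi (b i) d))
  hi-normalBoxes i d = cong fromℕ (begin
    toℕ (proj₁ entry) ⊔ toℕ (proj₂ entry)
      ≡⟨ cong (λ e → toℕ (proj₁ e) ⊔ toℕ (proj₂ e)) (table-tableIndex normalTable i d) ⟩
    toℕ (proj₁ (normalTable i d)) ⊔ toℕ (proj₂ (normalTable i d))
      ≡⟨ cong₂ _⊔_ (Fin.toℕ-fromℕ< (rank< d (Box.lo (b i) d)))
                   (Fin.toℕ-fromℕ< (rank< d (Box.hi (b i) d))) ⟩
    rank (endpoints d) (Box.lo (b i) d) ⊔ rank (endpoints d) (Box.hi (b i) d)
      ≡⟨ ℕ.m≤n⇒m⊔n≡n (rank-mono-≤ (endpoints d) (Box.lo≤hi (b i) d)) ⟩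
    rank (endpoints d) (Box.hi (b i) d) ∎)
    where
    open ≡-Reasoning
    entry : Fin (suc (n + n)) × Fin (suc (n + n))
    entry = table {n} {m} {suc (n + n)} (tableIndex normalTable) i d

  sameEndpointOrder : SameEndpointOrder b normalBoxes
  sameEndpointOrder i j d = subst₂ (λ x y → Box.lo (b i) d ℚ.≤ Box.hi (b j) d ⇔ x ℚ.≤ y)
    (sym (lo-normalBoxes i d)) (sym (hi-normalBoxes j d))
    (⇔.trans (⇔.sym (rank-≤⇔ (endpoints d) hi∈endpoints)) (⇔.sym fromℕ-≤⇔))
    where
    hi∈endpoints : Box.hi (b j) d ∈ endpoints d
    hi∈endpoints = ∈.∈-++⁺ʳ (tabulate (λ i → Box.lo (b i) d)) (∈.∈-tabulate⁺ j)

codeGraph : ∀ n m → Fin ((suc (n + n) * suc (n + n)) ^ (n * m)) → Graph n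
codeGraph n m = intersectionGraph ∘ tableBoxes ∘ table {n} {m} {suc (n + n)}

coverList : ∀ n m → List (Graph n)
coverList n m = map (codeGraph n m) (allFin _)

length-coverList : ∀ n m → length (coverList n m) ≡ (suc (n + n) * suc (n + n)) ^ (n * m)
length-coverList n m = trans (List.length-map (codeGraph n m) (allFin _))
                             (List.length-tabulate {n = (suc (n + n) * suc (n + n)) ^ (n * m)} id)

∈-coverList⇔ : ∀ {n m} (G : Graph n) → Graph.adj G ∈ map Graph.adj (coverList n m) ⇔ IsBoxGraph m G
∈-coverList⇔ {n} {m} G = mk⇔ to from
  where
  to : Graph.adj G ∈ map Graph.adj (coverList n m) → IsBoxGraph m G
  to G∈ =
    let H , H∈ , G≡H = ∈.∈-map⁻ Graph.adj G∈
        k , _ , H≡k  = ∈.∈-map⁻ (codeGraph n m) H∈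
        b            = tableBoxes (table {n} {m} {suc (n + n)} k)
    in  b , Equivalence.from (isIntersectionGraphOf⇔adj≡ G b) (trans G≡H (cong Graph.adj H≡k))

  from : IsBoxGraph m G → Graph.adj G ∈ map Graph.adj (coverList n m)
  from (b , G∼b) = subst (_∈ map Graph.adj (coverList n m)) (sym G≡normal)
    (∈.∈-map⁺ Graph.adj (∈.∈-map⁺ (codeGraph n m) (∈.∈-allFin (tableIndex normalTable))))
    where
    open Normalisation b
    G≡normal : Graph.adj G ≡ Graph.adj (intersectionGraph normalBoxes)
    G≡normal = Equivalence.to (isIntersectionGraphOf⇔adj≡ G normalBoxes)
                 (isIntersectionGraphOf-resp {G = G} b normalBoxes sameEndpointOrder G∼b)

boxGraphCount : ∀ m n → Σ ℕ (BoxGraphCount m n)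
boxGraphCount m n = boxGraphCount-deduplicate (coverList n m) ∈-coverList⇔

boxGraphCount≤ : ∀ {m n c} → BoxGraphCount m n c → c ≤ (suc (n + n) * suc (n + n)) ^ (n * m)
boxGraphCount≤ {m} {n} count = subst (_ ≤_) (length-coverList n m)
  (boxGraphCount≤length count (coverList n m) (λ G → Equivalence.from (∈-coverList⇔ G)))

interval-⊆ : ∀ {r a b a' b'} → a ≤ b → b < r →
             (∀ p → p < r → a ≤ p × p ≤ b → a' ≤ p × p ≤ b') → a' ≤ a × b ≤ b'
interval-⊆ a≤b b<r ⊆ =
  proj₁ (⊆ _ (ℕ.≤-<-trans a≤b b<r) (ℕ.≤-refl , a≤b)) , proj₂ (⊆ _ b<r (a≤b , ℕ.≤-refl))

interval-ext : ∀ {r a b a' b'} → a ≤ b → b < r → a' ≤ b' → b' < r →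
               (∀ p → p < r → (a ≤ p × p ≤ b) ⇔ (a' ≤ p × p ≤ b')) → a ≡ a' × b ≡ b'
interval-ext a≤b b<r a'≤b' b'<r same
  with interval-⊆ a≤b b<r (λ p p<r → Equivalence.to (same p p<r))
     | interval-⊆ a'≤b' b'<r (λ p p<r → Equivalence.from (same p p<r))
... | a'≤a , b≤b' | a≤a' , b'≤b = ℕ.≤-antisym a≤a' a'≤a , ℕ.≤-antisym b≤b' b'≤b

module Gadget (f m h : ℕ) where

  Window : Fin h × Fin h → ℕ → Set
  Window (x , y) p = toℕ x ≤ p × p ≤ h + toℕ y

  window-ordered : ∀ (xy : Fin h × Fin h) → toℕ (proj₁ xy) ≤ h + toℕ (proj₂ xy)
  window-ordered (x , _) = ℕ.≤-trans (ℕ.<⇒≤ (Fin.toℕ<n x)) (ℕ.m≤m+n h _)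

  window-bounded : ∀ (xy : Fin h × Fin h) → h + toℕ (proj₂ xy) < h + h
  window-bounded (_ , y) = ℕ.+-monoʳ-< h (Fin.toℕ<n y)

  freeBox : (Fin m → Fin h × Fin h) → Box m
  freeBox ψ = ℕBox (toℕ ∘ proj₁ ∘ ψ) (λ d → h + toℕ (proj₂ (ψ d))) (window-ordered ∘ ψ)

  probeInterval : Fin m → Fin (h + h) → Fin m → ℕ × ℕ
  probeInterval d₀ p d with d Fin.≟ d₀
  ... | yes _ = toℕ p , toℕ p
  ... | no  _ = 0 , h + h

  probeInterval-ordered : ∀ d₀ p d → proj₁ (probeInterval d₀ p d) ≤ proj₂ (probeInterval d₀ p d)
  probeInterval-ordered d₀ p d with d Fin.≟ d₀
  ... | yes _ = ℕ.≤-refl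
  ... | no  _ = z≤n

  probeBox : Fin m → Fin (h + h) → Box m
  probeBox d₀ p =
    ℕBox (proj₁ ∘ probeInterval d₀ p) (proj₂ ∘ probeInterval d₀ p) (probeInterval-ordered d₀ p)

  freeBox-meets-probeBox : ∀ ψ d₀ p → Intersect (freeBox ψ) (probeBox d₀ p) ⇔ Window (ψ d₀) (toℕ p)
  freeBox-meets-probeBox ψ d₀ p =
    ⇔.trans (ℕBox-intersect⇔ (window-ordered ∘ ψ) (probeInterval-ordered d₀ p)) (mk⇔ to from)
    where
    to : (∀ d → toℕ (proj₁ (ψ d)) ≤ proj₂ (probeInterval d₀ p d) ×
                proj₁ (probeInterval d₀ p d) ≤ h + toℕ (proj₂ (ψ d))) →
         Window (ψ d₀) (toℕ p)
    to meets with meets d₀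
    ... | meets₀ with d₀ Fin.≟ d₀
    ...   | yes _   = meets₀
    ...   | no  d≢d = ⊥-elim (d≢d refl)

    from : Window (ψ d₀) (toℕ p) →
           ∀ d → toℕ (proj₁ (ψ d)) ≤ proj₂ (probeInterval d₀ p d) ×
                 proj₁ (probeInterval d₀ p d) ≤ h + toℕ (proj₂ (ψ d))
    from window d with d Fin.≟ d₀
    ... | yes refl = window
    ... | no  _    = ℕ.≤-trans (ℕ.<⇒≤ (Fin.toℕ<n (proj₁ (ψ d)))) (ℕ.m≤m+n h h) , z≤n

  gadget : Table f m h → Fin (f + m * (h + h)) → Box m
  gadget φ v = [ freeBox ∘ φ , uncurry probeBox ∘ remQuot (h + h) ]′ (splitAt f v)

  free : Fin f → Fin (f + m * (h + h))
  free i = i ↑ˡ (m * (h + h))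

  probe : Fin m → Fin (h + h) → Fin (f + m * (h + h))
  probe d p = f ↑ʳ combine d p

  free≢probe : ∀ i d p → free i ≢ probe d p
  free≢probe i d p eq
    with trans (sym (Fin.splitAt-↑ˡ f i _)) (trans (cong (splitAt f) eq) (Fin.splitAt-↑ʳ f _ _))
  ... | ()

  gadget-free : ∀ φ i → gadget φ (free i) ≡ freeBox (φ i)
  gadget-free φ i = cong [ freeBox ∘ φ , uncurry probeBox ∘ remQuot (h + h) ]′ (Fin.splitAt-↑ˡ f i _)

  gadget-probe : ∀ φ d p → gadget φ (probe d p) ≡ probeBox d p
  gadget-probe φ d p =
    trans (cong [ freeBox ∘ φ , uncurry probeBox ∘ remQuot (h + h) ]′ (Fin.splitAt-↑ʳ f _ _))
          (cong (uncurry probeBox) (Fin.remQuot-combine d p))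

  Adj-free-probe : ∀ φ i d p →
                   Adj (intersectionGraph (gadget φ)) (free i) (probe d p) ⇔ Window (φ i d) (toℕ p)
  Adj-free-probe φ i d p = ⇔.trans (Adj-intersectionGraph (gadget φ) (free≢probe i d p))
    (subst₂ (λ A B → Intersect A B ⇔ Window (φ i d) (toℕ p))
            (sym (gadget-free φ i)) (sym (gadget-probe φ d p)) (freeBox-meets-probeBox (φ i) d p))

  gadget-injective : ∀ φ φ' →
                     Graph.adj (intersectionGraph (gadget φ)) ≡ Graph.adj (intersectionGraph (gadget φ')) →
                     ∀ i d → φ i d ≡ φ' i d
  gadget-injective φ φ' same i d =
    ×-≡,≡→≡ (Fin.toℕ-injective (proj₁ ends) , Fin.toℕ-injective (ℕ.+-cancelˡ-≡ h _ _ (proj₂ ends)))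
    where
    G G' : Graph (f + m * (h + h))
    G  = intersectionGraph (gadget φ)
    G' = intersectionGraph (gadget φ')

    same-window : ∀ p → p < h + h → Window (φ i d) p ⇔ Window (φ' i d) p
    same-window p p<2h = subst (λ p → Window (φ i d) p ⇔ Window (φ' i d) p) (Fin.toℕ-fromℕ< p<2h) (begin
      Window (φ i d) (toℕ q)       ≈⟨ Adj-free-probe φ i d q ⟨
      Adj G (free i) (probe d q)   ≈⟨ Adj-resp G G' same (free i) (probe d q) ⟩
      Adj G' (free i) (probe d q)  ≈⟨ Adj-free-probe φ' i d q ⟩
      Window (φ' i d) (toℕ q)      ∎)
      where
      open import Relation.Binary.Reasoning.Setoid (⇔.⇔-setoid 0ℓ)
      q : Fin (h + h)
      q = fromℕ< p<2h

    ends : toℕ (proj₁ (φ i d)) ≡ toℕ (proj₁ (φ' i d)) ×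
           h + toℕ (proj₂ (φ i d)) ≡ h + toℕ (proj₂ (φ' i d))
    ends = interval-ext (window-ordered (φ i d)) (window-bounded (φ i d))
                        (window-ordered (φ' i d)) (window-bounded (φ' i d)) same-window

boxGraphCount≥ : ∀ {m n c} → BoxGraphCount m n c →
                 ∀ f h → f + m * (h + h) ≡ n → (h * h) ^ (f * m) ≤ c
boxGraphCount≥ {m} count f h refl = injective≤boxGraphCount count
  (intersectionGraph ∘ gadget ∘ table {f} {m} {h})
  (λ s → intersectionGraph-isBoxGraph (gadget (table s)))
  (λ {s} {t} same → table-injective (gadget-injective (table s) (table t) same))
  where open Gadget f m h

^-distribʳ-* : ∀ a b e → (a * b) ^ e ≡ a ^ e * b ^ e
^-distribʳ-* a b zero    = refl
^-distribʳ-* a b (suc e) = trans (cong (a * b *_) (^-distribʳ-* a b e)) (interchange a b (a ^ e) (b ^ e))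
  where
  interchange : ∀ a b x y → a * b * (x * y) ≡ a * x * (b * y)
  interchange = solve-∀

square-^ : ∀ a e → (a * a) ^ e ≡ a ^ (e + e)
square-^ a e = trans (^-distribʳ-* a a e) (sym (ℕ.^-distribˡ-+-* a e e))

square-cancel-≤ : ∀ {x y} → x * x ≤ y * y → x ≤ y
square-cancel-≤ {x} {y} x²≤y² with x ℕ.≤? y
... | yes x≤y = x≤y
... | no  x≰y = ⊥-elim (ℕ.<⇒≱ (ℕ.*-mono-< (ℕ.≰⇒> x≰y) (ℕ.≰⇒> x≰y)) x²≤y²)

m*n≤o⇒m≤o/n : ∀ {m n o} .{{_ : NonZero n}} → m * n ≤ o → m ≤ o / n
m*n≤o⇒m≤o/n {m} {n} m*n≤o = subst (_≤ _ / n) (DivMod.m*n/n≡m m n) (DivMod./-monoˡ-≤ n m*n≤o)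

n*[m/n]≤m : ∀ m n .{{_ : NonZero n}} → n * (m / n) ≤ m
n*[m/n]≤m m n = subst (_≤ m) (ℕ.*-comm (m / n) n) (DivMod.m/n*n≤m m n)

m≤2*n*[m/n] : ∀ m n .{{_ : NonZero n}} → 1 ≤ m / n → m ≤ 2 * n * (m / n)
m≤2*n*[m/n] m n 1≤m/n = begin
  m                         ≡⟨ DivMod.m≡m%n+[m/n]*n m n ⟩
  m % n + m / n * n         ≤⟨ ℕ.+-monoˡ-≤ (m / n * n) (ℕ.<⇒≤ (DivMod.m%n<n m n)) ⟩
  n + m / n * n             ≤⟨ ℕ.+-monoˡ-≤ (m / n * n) (ℕ.m≤m*n n (m / n) {{ℕ.>-nonZero 1≤m/n}}) ⟩
  n * (m / n) + m / n * n   ≡⟨ twice n (m / n) ⟩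
  2 * n * (m / n)           ∎
  where
  open ℕ.≤-Reasoning
  twice : ∀ n q → n * q + q * n ≡ 2 * n * q
  twice = solve-∀

upper-estimate : ∀ m k n → 9 ^ (m * k) ≤ n →
                 ((suc (n + n) * suc (n + n)) ^ (n * m)) ^ k ≤ n ^ ((2 * m * k + 1) * n)
upper-estimate m k n 9^mk≤n = begin
  ((P * P) ^ (n * m)) ^ k          ≤⟨ ℕ.^-monoˡ-≤ k (ℕ.^-monoˡ-≤ (n * m) P²≤9n²) ⟩
  ((9 * (n * n)) ^ (n * m)) ^ k    ≡⟨ ℕ.^-*-assoc (9 * (n * n)) (n * m) k ⟩
  (9 * (n * n)) ^ e                ≡⟨ ^-distribʳ-* 9 (n * n) e ⟩
  9 ^ e * (n * n) ^ e
    ≡⟨ cong₂ _*_ (trans (cong (9 ^_) (reorder m k n)) (sym (ℕ.^-*-assoc 9 (m * k) n))) (square-^ n e) ⟩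
  (9 ^ (m * k)) ^ n * n ^ (e + e)  ≤⟨ ℕ.*-monoˡ-≤ (n ^ (e + e)) (ℕ.^-monoˡ-≤ n 9^mk≤n) ⟩
  n ^ n * n ^ (e + e)              ≡⟨ ℕ.^-distribˡ-+-* n n (e + e) ⟨
  n ^ (n + (e + e))                ≡⟨ cong (n ^_) (exponent m k n) ⟩
  n ^ ((2 * m * k + 1) * n)        ∎
  where
  open ℕ.≤-Reasoning
  P e : ℕ
  P = suc (n + n)
  e = n * m * k

  reorder : ∀ m k n → n * m * k ≡ m * k * n
  reorder = solve-∀
  exponent : ∀ m k n → n + (n * m * k + n * m * k) ≡ (2 * m * k + 1) * n
  exponent = solve-∀
  thrice-squared : ∀ n → (n + (n + n)) * (n + (n + n)) ≡ 9 * (n * n)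
  thrice-squared = solve-∀

  P²≤9n² : P * P ≤ 9 * (n * n)
  P²≤9n² = subst (P * P ≤_) (thrice-squared n) (ℕ.*-mono-≤ P≤3n P≤3n)
    where
    P≤3n : P ≤ n + (n + n)
    P≤3n = ℕ.+-monoˡ-≤ (n + n) (ℕ.≤-trans (ℕ.m^n>0 9 (m * k)) 9^mk≤n)

-- Squares are compared because (C h)^(2 A n) ≤ h^((2 A + 1) n) needs only C^(2 A) ≤ h,
-- and the hypotheses give (2 A + 1) n ≤ 4 f m k.
lower-estimate : ∀ {m k A n f h C} .{{_ : NonZero h}} → 2 * m * k ≡ suc A → f + m * (h + h) ≡ n →
                 4 * (m * k) * (m * (h + h)) ≤ n → n ≤ C * h → C ^ (2 * A) ≤ h →
                 n ^ (A * n) ≤ ((h * h) ^ (f * m)) ^ k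
lower-estimate {m} {k} {A} {n} {f} {h} {C} 2mk≡1+A f+2mh≡n 4mk·2mh≤n n≤Ch C^2A≤h =
  square-cancel-≤ (begin
    n ^ (A * n) * n ^ (A * n)                ≡⟨ ℕ.^-distribˡ-+-* n (A * n) (A * n) ⟨
    n ^ (A * n + A * n)                      ≤⟨ ℕ.^-monoˡ-≤ (A * n + A * n) n≤Ch ⟩
    (C * h) ^ (A * n + A * n)                ≡⟨ ^-distribʳ-* C h (A * n + A * n) ⟩
    C ^ (A * n + A * n) * h ^ (A * n + A * n)
      ≡⟨ cong (_* h ^ (A * n + A * n)) (trans (cong (C ^_) (double A n)) (sym (ℕ.^-*-assoc C (2 * A) n))) ⟩
    (C ^ (2 * A)) ^ n * h ^ (A * n + A * n)  ≤⟨ ℕ.*-monoˡ-≤ (h ^ (A * n + A * n)) (ℕ.^-monoˡ-≤ n C^2A≤h) ⟩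
    h ^ n * h ^ (A * n + A * n)              ≡⟨ ℕ.^-distribˡ-+-* h n (A * n + A * n) ⟨
    h ^ (n + (A * n + A * n))                ≤⟨ ℕ.^-monoʳ-≤ h exponent-bound ⟩
    h ^ (e + e + (e + e))                    ≡⟨ ℕ.^-distribˡ-+-* h (e + e) (e + e) ⟩
    h ^ (e + e) * h ^ (e + e)                ≡⟨ cong₂ _*_ count≡ count≡ ⟨
    ((h * h) ^ (f * m)) ^ k * ((h * h) ^ (f * m)) ^ k ∎)
  where
  open ℕ.≤-Reasoning
  e : ℕ
  e = f * m * k

  count≡ : ((h * h) ^ (f * m)) ^ k ≡ h ^ (e + e)
  count≡ = trans (ℕ.^-*-assoc (h * h) (f * m) k) (square-^ h e)

  double : ∀ A n → A * n + A * n ≡ 2 * A * n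
  double = solve-∀
  odd-multiple : ∀ A n → n + (A * n + A * n) + n ≡ 2 * suc A * n
  odd-multiple = solve-∀
  expand : ∀ m k f h → 2 * (2 * m * k) * (f + m * (h + h)) ≡
                       f * m * k + f * m * k + (f * m * k + f * m * k) + 4 * (m * k) * (m * (h + h))
  expand = solve-∀

  exponent-bound : n + (A * n + A * n) ≤ e + e + (e + e)
  exponent-bound = ℕ.+-cancelʳ-≤ n _ _ (begin
    n + (A * n + A * n) + n                        ≡⟨ odd-multiple A n ⟩
    2 * suc A * n                                  ≡⟨ cong (λ x → 2 * x * n) 2mk≡1+A ⟨
    2 * (2 * m * k) * n                            ≡⟨ cong (2 * (2 * m * k) *_) f+2mh≡n ⟨
    2 * (2 * m * k) * (f + m * (h + h))            ≡⟨ expand m k f h ⟩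
    e + e + (e + e) + 4 * (m * k) * (m * (h + h))  ≤⟨ ℕ.+-monoʳ-≤ (e + e + (e + e)) 4mk·2mh≤n ⟩
    e + e + (e + e) + n                            ∎)

boxGraphCount-upper : ∀ {m n c} k → BoxGraphCount m n c → 9 ^ (m * k) ≤ n →
                      c ^ k ≤ n ^ ((2 * m * k + 1) * n)
boxGraphCount-upper {m} {n} k count 9^mk≤n =
  ℕ.≤-trans (ℕ.^-monoˡ-≤ k (boxGraphCount≤ count)) (upper-estimate m k n 9^mk≤n)

lowerThreshold : ℕ → ℕ → ℕ
lowerThreshold m k = (2 * C) ^ (2 * (2 * m * k ∸ 1)) * C
  where
  C : ℕ
  C = 8 * m * m * k

boxGraphCount-lower : ∀ {m k n c} → 1 ≤ m → 1 ≤ k → BoxGraphCount m n c → lowerThreshold m k ≤ n →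
                      n ^ ((2 * m * k ∸ 1) * n) ≤ c ^ k
boxGraphCount-lower {m@(suc _)} {k@(suc _)} {n} (s≤s z≤n) (s≤s z≤n) count large =
  ℕ.≤-trans (lower-estimate {m} {k} {2 * m * k ∸ 1} {n} {f} {h} {2 * C}
                           refl f+2mh≡n 4mk·2mh≤n (m≤2*n*[m/n] n C 1≤h) T≤h)
            (ℕ.^-monoˡ-≤ k (boxGraphCount≥ count f h f+2mh≡n))
  where
  C h f : ℕ
  C = 8 * m * m * k
  h = n / C
  f = n ∸ m * (h + h)

  T≤h : (2 * C) ^ (2 * (2 * m * k ∸ 1)) ≤ h
  T≤h = m*n≤o⇒m≤o/n large

  1≤h : 1 ≤ h
  1≤h = ℕ.≤-trans (ℕ.m^n>0 (2 * C) (2 * (2 * m * k ∸ 1))) T≤h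

  instance
    h≢0 : NonZero h
    h≢0 = ℕ.>-nonZero 1≤h

  regroup : ∀ m k h → 8 * m * m * k * h ≡ 4 * (m * k) * (m * (h + h))
  regroup = solve-∀

  4mk·2mh≤n : 4 * (m * k) * (m * (h + h)) ≤ n
  4mk·2mh≤n = subst (_≤ n) (regroup m k h) (n*[m/n]≤m n C)

  f+2mh≡n : f + m * (h + h) ≡ n
  f+2mh≡n = ℕ.m∸n+n≡m (ℕ.≤-trans (ℕ.m≤n*m (m * (h + h)) (4 * (m * k))) 4mk·2mh≤n)

corollary2p8 : (m : ℕ) → 1 ≤ m → (k : ℕ) → 1 ≤ k →
    Σ ℕ λ N → (n : ℕ) → N ≤ n →
      Σ ℕ λ c → BoxGraphCount m n c ×
        (n ^ ((2 * m * k ∸ 1) * n) ≤ c ^ k) × (c ^ k ≤ n ^ ((2 * m * k + 1) * n))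
corollary2p8 m 1≤m k 1≤k = lowerThreshold m k + 9 ^ (m * k) , λ n N≤n →
  let c , count = boxGraphCount m n in
  c , count ,
  boxGraphCount-lower 1≤m 1≤k count (ℕ.≤-trans (ℕ.m≤m+n _ _) N≤n) ,
  boxGraphCount-upper k count (ℕ.≤-trans (ℕ.m≤n+m _ _) N≤n)
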